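{- Every connected graph $G$ contains a spanning tree $T$ such that $\gamma_2^2(T) \leq \gamma_2^2(G)$.
   Context: For a graph $H$, $\gamma_2^2(H)$ is the minimum size of a set $X\subseteq V(H)$ such that every vertex of $V(H)\setminus X$ is at distance at most $2$ (in $H$) from some vertex of $X$ and any two distinct vertices of $X$ are at distance at least $3$ in $H$. -}

module Defs where

open import Data.Nat using (ℕ; _≤_; suc)
open import Data.Fin using (Fin)
open import Data.Fin.Subset using (Subset; _∈_; _∉_; ∣_∣)
open import Data.Bool using (Bool; true; false)
open import Data.List using (List; []; _∷_; length; head; last)
open import Data.List.Relation.Unary.Unique.Propositional using (Unique)
open import Data.Maybe using (Maybe; just; nothing)
open import Data.Product using (Σ; ∃; _×_; _,_)
open import Data.Sum using (_⊎_)
open import Data.Unit using (⊤)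
open import Data.Empty using (⊥)
open import Relation.Nullary using (¬_)
open import Relation.Binary.PropositionalEquality using (_≡_)

record Graph (n : ℕ) : Set where
  field
    adj    : Fin n → Fin n → Bool
    sym    : ∀ u v → adj u v ≡ adj v u
    irrefl : ∀ u → adj u u ≡ false
open Graph public

Adj : ∀ {n} → Graph n → Fin n → Fin n → Set
Adj G u v = adj G u v ≡ true

data Reach {n} (G : Graph n) : Fin n → Fin n → Set where
  here : ∀ {u} → Reach G u u
  step : ∀ {u w v} → Adj G u w → Reach G w v → Reach G u v

Connected : ∀ {n} → Graph n → Set
Connected G = ∀ u v → Reach G u v

ConsecAdj : ∀ {n} → Graph n → List (Fin n) → Set
ConsecAdj G []            = ⊤
ConsecAdj G (x ∷ [])      = ⊤
ConsecAdj G (x ∷ y ∷ xs)  = Adj G x y × ConsecAdj G (y ∷ xs)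

IsCycle : ∀ {n} → Graph n → List (Fin n) → Set
IsCycle G vs =
  (3 ≤ length vs) × Unique vs × ConsecAdj G vs ×
  (∃ λ a → ∃ λ b → head vs ≡ just a × last vs ≡ just b × Adj G b a)

Acyclic : ∀ {n} → Graph n → Set
Acyclic G = ∀ vs → ¬ IsCycle G vs

IsTree : ∀ {n} → Graph n → Set
IsTree T = Connected T × Acyclic T

SpanningSubgraph : ∀ {n} → Graph n → Graph n → Set
SpanningSubgraph T G = ∀ u v → Adj T u v → Adj G u v

IsSpanningTree : ∀ {n} → Graph n → Graph n → Set
IsSpanningTree T G = SpanningSubgraph T G × IsTree T

Dist≤2 : ∀ {n} → Graph n → Fin n → Fin n → Set
Dist≤2 H u v = u ≡ v ⊎ Adj H u v ⊎ (∃ λ w → Adj H u w × Adj H w v)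

IsDomInd22 : ∀ {n} → Graph n → Subset n → Set
IsDomInd22 H X =
  (∀ v → v ∉ X → ∃ λ x → x ∈ X × Dist≤2 H x v) ×
  (∀ x y → x ∈ X → y ∈ X → ¬ x ≡ y → ¬ Dist≤2 H x y)

IsGamma22 : ∀ {n} → Graph n → ℕ → Set
IsGamma22 H k =
  (∃ λ X → IsDomInd22 H X × ∣ X ∣ ≡ k) ×
  (∀ X → IsDomInd22 H X → k ≤ ∣ X ∣)

module Submission where

-- Let X realise γ₂²(G). Moving each vertex outside X one step towards a nearest vertex of X
-- gives a forest of height at most 2 in G whose roots are the vertices of X. Every such forest
-- extends to a spanning tree: layer its trees by their distance from a fixed tree once each tree
-- is contracted to a point, and re-root every tree of positive layer at a vertex adjacent to a
-- tree of smaller layer, which only reverses a path of length at most 2. In the resulting tree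
-- every vertex is still within distance 2 of X, and distances in a spanning subgraph are no
-- smaller than in G, so X is admissible for the tree and γ₂²(T) ≤ ∣ X ∣ = γ₂²(G).

open import Defs hiding (sym)
open import Data.Nat using (ℕ; zero; suc; _+_; _*_; _≤_; _<_; z≤n; s≤s) renaming (_≟_ to _≟ⁿ_)
open import Data.Nat.Properties
  using ( <-irrefl; <-trans; ≮⇒≥; <-≤-trans; ≤-antisym; m≤m+n; +-monoʳ-<; +-monoʳ-≤
        ; +-comm; *-monoˡ-≤; n<1+n; module ≤-Reasoning)
open import Data.Nat.Induction using (<-rec; <-wellFounded)
open import Induction.WellFounded using (module All)
import Relation.Binary.Construct.On as On
open import Data.Fin using (Fin; toℕ; fromℕ<) renaming (zero to fzero; _≟_ to _≟ᶠ_)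
open import Data.Fin.Properties using (any?; all?; toℕ<n; toℕ-fromℕ<)
open import Data.Fin.Subset using (Subset; _∈_; _∉_; ∣_∣)
open import Data.Fin.Subset.Properties using (_∈?_; anySubset?)
open import Data.Bool using (true) renaming (_≟_ to _≟ᵇ_)
open import Data.List using (List; []; _∷_; last)
open import Data.List.Relation.Unary.All using (All; _∷_)
open import Data.List.Relation.Unary.AllPairs using (AllPairs; _∷_)
open import Data.Maybe using (just)
open import Data.Product using (Σ; ∃; ∃₂; _×_; _,_; proj₁; proj₂)
open import Data.Sum using (_⊎_; inj₁; inj₂)
open import Data.Unit using (⊤; tt)
open import Data.Empty using (⊥; ⊥-elim)
open import Function using (_∘_; mk⇔)
open import Relation.Nullary using (¬_; Dec; yes; no; does)
open import Relation.Nullary.Decidable using (_×-dec_; _⊎-dec_; _→-dec_; ¬?; dec-true; dec-false; does-⇔)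
open import Relation.Unary using (Decidable)
open import Relation.Binary.PropositionalEquality
  using (_≡_; _≢_; refl; sym; trans; cong; cong₂; subst)

adj-sym : ∀ {n} (G : Graph n) {u v} → Adj G u v → Adj G v u
adj-sym G {u} {v} e = trans (Graph.sym G v u) e

adj⇒≢ : ∀ {n} (G : Graph n) {u v} → Adj G u v → u ≢ v
adj⇒≢ G {u} e refl with trans (sym (irrefl G u)) e
... | ()

reach-snoc : ∀ {n} {G : Graph n} {u w v} → Reach G u w → Adj G w v → Reach G u v
reach-snoc here        e = step e here
reach-snoc (step a r) e = step a (reach-snoc r e)

reach-sym : ∀ {n} {G : Graph n} {u v} → Reach G u v → Reach G v u
reach-sym         here       = here
reach-sym {G = G} (step a r) = reach-snoc (reach-sym r) (adj-sym G a)

reach-trans : ∀ {n} {G : Graph n} {u w v} → Reach G u w → Reach G w v → Reach G u v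
reach-trans here       r′ = r′
reach-trans (step a r) r′ = step a (reach-trans r r′)

adj? : ∀ {n} (G : Graph n) u v → Dec (Adj G u v)
adj? G u v = adj G u v ≟ᵇ true

does⇒ : ∀ {a} {A : Set a} (a? : Dec A) → does a? ≡ true → A
does⇒ (yes a) _ = a

least : ∀ {P : ℕ → Set} → Decidable P → ∀ m → P m → Σ ℕ λ k → P k × (∀ j → P j → k ≤ j)
least {P} P? = <-rec (λ m → P m → Least) search
  where
  Least : Set
  Least = Σ ℕ λ k → P k × (∀ j → P j → k ≤ j)
  search : ∀ m → (∀ {i} → i < m → P i → Least) → P m → Least
  search m rec pm with any? (λ (i : Fin m) → P? (toℕ i))
  ... | yes (i , pi) = rec (toℕ<n i) pi
  ... | no none      = m , pm , λ j pj → ≮⇒≥ λ j<m →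
                         none (fromℕ< j<m , subst P (sym (toℕ-fromℕ< j<m)) pj)

last⁺ : ∀ {A : Set} → A → List A → A
last⁺ x []       = x
last⁺ _ (y ∷ ys) = last⁺ y ys

penultimate : ∀ {A : Set} → A → A → List A → A
penultimate x _ []       = x
penultimate _ y (z ∷ zs) = penultimate y z zs

last-∷ : ∀ {A : Set} (x : A) xs → last (x ∷ xs) ≡ just (last⁺ x xs)
last-∷ x []       = refl
last-∷ _ (y ∷ ys) = last-∷ y ys

All-last⁺ : ∀ {A : Set} {P : A → Set} x xs → All P (x ∷ xs) → P (last⁺ x xs)
All-last⁺ x []       (px ∷ _)  = px
All-last⁺ _ (y ∷ ys) (_ ∷ pys) = All-last⁺ y ys pys

All-penultimate : ∀ {A : Set} {P : A → Set} x y ys → All P (x ∷ y ∷ ys) → P (penultimate x y ys)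
All-penultimate x y []       (px ∷ _)  = px
All-penultimate _ y (z ∷ zs) (_ ∷ ps) = All-penultimate y z zs ps

NoBacktrack : ∀ {A : Set} → List A → Set
NoBacktrack (x ∷ y ∷ z ∷ zs) = x ≢ z × NoBacktrack (y ∷ z ∷ zs)
NoBacktrack _                = ⊤

distinct⇒noBacktrack : ∀ {A : Set} {xs : List A} → AllPairs _≢_ xs → NoBacktrack xs
distinct⇒noBacktrack {xs = []}              _                     = tt
distinct⇒noBacktrack {xs = _ ∷ []}          _                     = tt
distinct⇒noBacktrack {xs = _ ∷ _ ∷ []}      _                     = tt
distinct⇒noBacktrack {xs = _ ∷ _ ∷ _ ∷ _} ((_ ∷ x≢z ∷ _) ∷ rest) = x≢z , distinct⇒noBacktrack rest

module ParentGraph {n} (p : Fin n → Fin n) where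

  Linked : Fin n → Fin n → Set
  Linked u v = (p u ≡ v ⊎ p v ≡ u) × u ≢ v

  linked? : ∀ u v → Dec (Linked u v)
  linked? u v = ((p u ≟ᶠ v) ⊎-dec (p v ≟ᶠ u)) ×-dec ¬? (u ≟ᶠ v)

  linked-sym : ∀ {u v} → Linked u v → Linked v u
  linked-sym (inj₁ e , u≢v) = inj₂ e , u≢v ∘ sym
  linked-sym (inj₂ e , u≢v) = inj₁ e , u≢v ∘ sym

  graph : Graph n
  graph = record
    { adj    = λ u v → does (linked? u v)
    ; sym    = λ u v → does-⇔ (mk⇔ linked-sym linked-sym) (linked? u v) (linked? v u)
    ; irrefl = λ u → dec-false (linked? u u) λ (_ , u≢u) → u≢u refl
    }

  adj⇒linked : ∀ {u v} → Adj graph u v → Linked u v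
  adj⇒linked {u} {v} = does⇒ (linked? u v)

  parent-edge : ∀ {u v} → p u ≡ v → u ≢ v → Adj graph u v
  parent-edge {u} {v} e u≢v = dec-true (linked? u v) (inj₁ e , u≢v)

  module Ranked (rk : Fin n → ℕ) (rk-parent : ∀ u → p u ≢ u → rk (p u) < rk u) where

    rk-up : ∀ {u v} → p u ≡ v → u ≢ v → rk v < rk u
    rk-up {u} refl u≢pu = rk-parent u (u≢pu ∘ sym)

    -- A backtrack-free walk that has stepped away from the root keeps doing so: stepping back
    -- towards the root would return to the vertex it came from.
    descending-walk : ∀ a b xs → ConsecAdj graph (a ∷ b ∷ xs) → NoBacktrack (a ∷ b ∷ xs) →
      p b ≡ a → rk a < rk (last⁺ b xs) × p (last⁺ b xs) ≡ penultimate a b xs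
    descending-walk a b []       (ab , _)  _           pb≡a =
      rk-up pb≡a (proj₂ (adj⇒linked ab) ∘ sym) , pb≡a
    descending-walk a b (c ∷ cs) (ab , bc) (a≢c , nb) pb≡a with adj⇒linked (proj₁ bc)
    ... | inj₁ pb≡c , _ = ⊥-elim (a≢c (trans (sym pb≡a) pb≡c))
    ... | inj₂ pc≡b , _ =
      let rk-b<last , last-descends = descending-walk b c cs bc nb pc≡b
      in  <-trans (rk-up pb≡a (proj₂ (adj⇒linked ab) ∘ sym)) rk-b<last , last-descends

    ascending-walk : ∀ a b xs → ConsecAdj graph (a ∷ b ∷ xs) → NoBacktrack (a ∷ b ∷ xs) →
      p a ≡ b → rk (last⁺ b xs) < rk a ⊎ p (last⁺ b xs) ≡ penultimate a b xs
    ascending-walk a b []       (ab , _)  _          pa≡b = inj₁ (rk-up pa≡b (proj₂ (adj⇒linked ab)))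
    ascending-walk a b (c ∷ cs) (ab , bc) (_ , nb) pa≡b with adj⇒linked (proj₁ bc)
    ... | inj₂ pc≡b , _ = inj₂ (proj₂ (descending-walk b c cs bc nb pc≡b))
    ... | inj₁ pb≡c , _ with ascending-walk b c cs bc nb pb≡c
    ...   | inj₁ rk-last<b = inj₁ (<-trans rk-last<b (rk-up pa≡b (proj₂ (adj⇒linked ab))))
    ...   | inj₂ last-descends = inj₂ last-descends

    -- Closing a cycle v₀ … b into the walk b v₀ … b keeps it free of backtracking; the walk
    -- lemmas then force rk b < rk b or two different parents of b.
    acyclic : Acyclic graph
    acyclic []                  (() , _)
    acyclic (_ ∷ [])            (s≤s () , _)
    acyclic (_ ∷ _ ∷ [])        (s≤s (s≤s ()) , _)
    acyclic (v₀ ∷ v₁ ∷ v₂ ∷ vs) (_ , v₀∉ ∷ v₁∉ ∷ distinct , walk , _ , b , refl , last≡b , ba)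
      with trans (sym last≡b) (last-∷ v₂ vs)
    ... | refl = orientation (adj⇒linked ba)
      where
      closed : ConsecAdj graph (b ∷ v₀ ∷ v₁ ∷ v₂ ∷ vs)
      closed = ba , walk
      noBacktrack : NoBacktrack (b ∷ v₀ ∷ v₁ ∷ v₂ ∷ vs)
      noBacktrack = All-last⁺ v₂ vs v₁∉ ∘ sym , distinct⇒noBacktrack (v₀∉ ∷ v₁∉ ∷ distinct)
      orientation : Linked b v₀ → ⊥
      orientation (inj₂ pv₀≡b , _) =
        <-irrefl refl (proj₁ (descending-walk b v₀ (v₁ ∷ v₂ ∷ vs) closed noBacktrack pv₀≡b))
      orientation (inj₁ pb≡v₀ , _) with ascending-walk b v₀ (v₁ ∷ v₂ ∷ vs) closed noBacktrack pb≡v₀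
      ... | inj₁ rk-b<rk-b = <-irrefl refl rk-b<rk-b
      ... | inj₂ pb≡pen    = All-penultimate v₁ v₂ vs v₀∉ (trans (sym pb≡v₀) pb≡pen)

    connected : ∀ ρ → (∀ u → p u ≡ u → u ≡ ρ) → Connected graph
    connected ρ root-unique u v = reach-trans (reach-root u) (reach-sym (reach-root v))
      where
      reach-root : ∀ v → Reach graph v ρ
      reach-root = All.wfRec (On.wellFounded rk <-wellFounded) _ (λ v → Reach graph v ρ) climb
        where
        climb : ∀ v → (∀ {u} → rk u < rk v → Reach graph u ρ) → Reach graph v ρ
        climb v rec with p v ≟ᶠ v
        ... | yes root = subst (λ u → Reach graph u ρ) (sym (root-unique v root)) here
        ... | no moved = step (parent-edge refl (moved ∘ sym)) (rec (rk-parent v moved))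

module Layering {n} (G : Graph n) (conn : Connected G) (c : Fin n → Fin n) (r : Fin n) where

  -- The class of v is at distance at most k from the class of r in the graph G with
  -- every class of c contracted to a single vertex.
  Within : ℕ → Fin n → Set
  Within zero    v = c v ≡ c r
  Within (suc k) v = Within k v ⊎ ∃₂ λ u w → Within k u × Adj G u w × c w ≡ c v

  within? : ∀ k → Decidable (Within k)
  within? zero    v = c v ≟ᶠ c r
  within? (suc k) v = within? k v ⊎-dec
    any? λ u → any? λ w → within? k u ×-dec adj? G u w ×-dec (c w ≟ᶠ c v)

  within-resp : ∀ {k u v} → c u ≡ c v → Within k u → Within k v
  within-resp {zero}  cu≡cv cu≡cr = trans (sym cu≡cv) cu≡cr
  within-resp {suc k} cu≡cv (inj₁ within) = inj₁ (within-resp cu≡cv within)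
  within-resp {suc k} cu≡cv (inj₂ (s , t , s-within , st , ct≡cu)) =
    inj₂ (s , t , s-within , st , trans ct≡cu cu≡cv)

  within-reach : ∀ {k u v} → Within k u → Reach G u v → ∃ λ j → Within j v
  within-reach {k}     within here                    = k , within
  within-reach {u = u} within (step {w = w} uw reach) =
    within-reach (inj₂ (u , w , within , uw , refl)) reach

  private
    layering : ∀ v → Σ ℕ λ k → Within k v × (∀ j → Within j v → k ≤ j)
    layering v = let k , within = within-reach {zero} refl (conn r v)
                 in  least (λ j → within? j v) k within

  layer : Fin n → ℕ
  layer v = proj₁ (layering v)

  layer-within : ∀ v → Within (layer v) v
  layer-within v = proj₁ (proj₂ (layering v))

  layer-minimal : ∀ {v} k → Within k v → layer v ≤ k
  layer-minimal {v} = proj₂ (proj₂ (layering v))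

  layer-resp : ∀ {u v} → c u ≡ c v → layer u ≡ layer v
  layer-resp {u} {v} cu≡cv = ≤-antisym
    (layer-minimal (layer v) (within-resp (sym cu≡cv) (layer-within v)))
    (layer-minimal (layer u) (within-resp cu≡cv (layer-within u)))

  layer-zero : ∀ {v} → layer v ≡ 0 → c v ≡ c r
  layer-zero {v} eq = subst (λ k → Within k v) eq (layer-within v)

  entry : ∀ {v k} → layer v ≡ suc k → ∃₂ λ a b → c a ≡ c v × Adj G b a × layer b < layer v
  entry {v} {k} eq with subst (λ j → Within j v) eq (layer-within v)
  ... | inj₁ within = ⊥-elim (<-irrefl refl (subst (_≤ k) eq (layer-minimal k within)))
  ... | inj₂ (b , a , b-within , ba , ca≡cv) =
    a , b , ca≡cv , ba , subst (layer b <_) (sym eq) (s≤s (layer-minimal k b-within))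

record HeightTwoForest {n} (G : Graph n) : Set where
  field
    parent     : Fin n → Fin n
    parent-adj : ∀ v → parent v ≢ v → Adj G v (parent v)
    -- roots are the fixed points of parent, and every vertex reaches one in two steps
    height≤2   : ∀ v → parent (parent (parent v)) ≡ parent (parent v)

module Rerooting {n} {G : Graph n} (F : HeightTwoForest G) where
  open HeightTwoForest F

  root : Fin n → Fin n
  root v = parent (parent v)

  root-parent : ∀ v → root (parent v) ≡ root v
  root-parent = height≤2

  root-root : ∀ v → root (root v) ≡ root v
  root-root v = trans (cong parent (height≤2 v)) (height≤2 v)

  root-fixed : ∀ {v} → parent v ≡ v → root v ≡ v
  root-fixed fixed = trans (cong parent fixed) fixed

  depth : Fin n → ℕ
  depth v with parent v ≟ᶠ v | root v ≟ᶠ parent v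
  ... | yes _ | _     = 0
  ... | no _  | yes _ = 1
  ... | no _  | no _  = 2

  depth≤2 : ∀ v → depth v ≤ 2
  depth≤2 v with parent v ≟ᶠ v | root v ≟ᶠ parent v
  ... | yes _ | _     = z≤n
  ... | no _  | yes _ = s≤s z≤n
  ... | no _  | no _  = s≤s (s≤s z≤n)

  depth-parent : ∀ v → parent v ≢ v → depth (parent v) < depth v
  depth-parent v moved with parent v ≟ᶠ v | root v ≟ᶠ parent v
  ... | yes fixed | _ = ⊥-elim (moved fixed)
  ... | no _ | yes _ = s≤s z≤n
  ... | no _ | no _ with root (parent v) ≟ᶠ root v
  ...   | yes _          = s≤s (s≤s z≤n)
  ...   | no not-rooted = ⊥-elim (not-rooted (root-parent v))

  -- Re-roots the tree of a at a and hangs it below b, reversing the path a, parent a, root a.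
  opaque
    reroot : Fin n → Fin n → Fin n → Fin n
    reroot a b v with v ≟ᶠ a | v ≟ᶠ parent a | v ≟ᶠ root a
    ... | yes _ | _     | _     = b
    ... | no _  | yes _ | _     = a
    ... | no _  | no _  | yes _ = parent a
    ... | no _  | no _  | no _  = parent v

    position : Fin n → Fin n → ℕ
    position a v with v ≟ᶠ a | v ≟ᶠ parent a | v ≟ᶠ root a
    ... | yes _ | _     | _     = 0
    ... | no _  | yes _ | _     = 1
    ... | no _  | no _  | yes _ = 2
    ... | no _  | no _  | no _  = 3 + depth v

    reroot-self : ∀ a b → reroot a b a ≡ b
    reroot-self a b with a ≟ᶠ a
    ... | yes _ = refl
    ... | no a≢a = ⊥-elim (a≢a refl)

    position-self : ∀ a → position a a ≡ 0
    position-self a with a ≟ᶠ a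
    ... | yes _ = refl
    ... | no a≢a = ⊥-elim (a≢a refl)

    position-parent : ∀ a → parent a ≢ a → position a (parent a) ≡ 1
    position-parent a moved with parent a ≟ᶠ a | parent a ≟ᶠ parent a
    ... | yes fixed | _ = ⊥-elim (moved fixed)
    ... | no _ | yes _ = refl
    ... | no _ | no ≢-refl = ⊥-elim (≢-refl refl)

    reroot-parent : ∀ a b → parent a ≢ a → reroot a b (parent a) ≡ a
    reroot-parent a b moved with parent a ≟ᶠ a | parent a ≟ᶠ parent a
    ... | yes fixed | _ = ⊥-elim (moved fixed)
    ... | no _ | yes _ = refl
    ... | no _ | no ≢-refl = ⊥-elim (≢-refl refl)

    reroot-grandparent : ∀ a b → root a ≢ a → root a ≢ parent a → reroot a b (root a) ≡ parent a
    reroot-grandparent a b ≢a ≢pa with root a ≟ᶠ a | root a ≟ᶠ parent a | root a ≟ᶠ root a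
    ... | yes ≡a | _ | _ = ⊥-elim (≢a ≡a)
    ... | no _ | yes ≡pa | _ = ⊥-elim (≢pa ≡pa)
    ... | no _ | no _ | yes _ = refl
    ... | no _ | no _ | no ≢-refl = ⊥-elim (≢-refl refl)

    position≤5 : ∀ a v → position a v ≤ 5
    position≤5 a v with v ≟ᶠ a | v ≟ᶠ parent a | v ≟ᶠ root a
    ... | yes _ | _     | _     = z≤n
    ... | no _  | yes _ | _     = s≤s z≤n
    ... | no _  | no _  | yes _ = s≤s (s≤s z≤n)
    ... | no _  | no _  | no _  = s≤s (s≤s (s≤s (depth≤2 v)))

    position-off-path : ∀ a v → position a v < 3 ⊎ position a v ≡ 3 + depth v
    position-off-path a v with v ≟ᶠ a | v ≟ᶠ parent a | v ≟ᶠ root a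
    ... | yes _ | _     | _     = inj₁ (s≤s z≤n)
    ... | no _  | yes _ | _     = inj₁ (s≤s (s≤s z≤n))
    ... | no _  | no _  | yes _ = inj₁ (s≤s (s≤s (s≤s z≤n)))
    ... | no _  | no _  | no _  = inj₂ refl

    reroot-adj : ∀ a b v → v ≢ a → reroot a b v ≢ v → Adj G v (reroot a b v)
    reroot-adj a b v v≢a moved with v ≟ᶠ a | v ≟ᶠ parent a | v ≟ᶠ root a
    ... | yes v≡a | _ | _ = ⊥-elim (v≢a v≡a)
    ... | no _ | yes refl | _ = adj-sym G (parent-adj a (moved ∘ sym))
    ... | no _ | no _ | yes refl = adj-sym G (parent-adj (parent a) (moved ∘ sym))
    ... | no _ | no _ | no _ = parent-adj v moved

    reroot-root : ∀ a b v → v ≢ a → root (reroot a b v) ≡ root v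
    reroot-root a b v v≢a with v ≟ᶠ a | v ≟ᶠ parent a | v ≟ᶠ root a
    ... | yes v≡a | _ | _ = ⊥-elim (v≢a v≡a)
    ... | no _ | yes refl | _ = sym (root-parent a)
    ... | no _ | no _ | yes refl = trans (root-parent a) (sym (root-root a))
    ... | no _ | no _ | no _ = root-parent v

    reroot-position : ∀ a b v → v ≢ a → reroot a b v ≢ v → position a (reroot a b v) < position a v
    reroot-position a b v v≢a moved with v ≟ᶠ a | v ≟ᶠ parent a | v ≟ᶠ root a
    ... | yes v≡a | _ | _ = ⊥-elim (v≢a v≡a)
    ... | no _ | yes _ | _ rewrite position-self a = s≤s z≤n
    ... | no _ | no v≢pa | yes refl
      rewrite position-parent a (λ fixed → v≢pa (cong parent fixed)) = s≤s (s≤s z≤n)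
    ... | no _ | no _ | no _ with position-off-path a (parent v)
    ...   | inj₁ on-path = <-≤-trans on-path (m≤m+n 3 (depth v))
    ...   | inj₂ off-path rewrite off-path = +-monoʳ-< 3 (depth-parent v moved)

    reroot-fixed : ∀ a b v → root a ≡ root v → reroot a b v ≡ v → v ≡ a × b ≡ a
    reroot-fixed a b v same-tree fixed with v ≟ᶠ a | v ≟ᶠ parent a | v ≟ᶠ root a
    ... | yes refl | _ | _ = refl , fixed
    ... | no v≢a | yes _ | _ = ⊥-elim (v≢a (sym fixed))
    ... | no _ | no v≢pa | yes _ = ⊥-elim (v≢pa (sym fixed))
    ... | no _ | no _ | no v≢ra = ⊥-elim (v≢ra (sym (trans same-tree (trans (cong parent fixed) fixed))))

    reroot-keeps-edge : ∀ a b v → parent v ≢ v → reroot a b v ≡ parent v ⊎ reroot a b (parent v) ≡ v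
    reroot-keeps-edge a b v moved with v ≟ᶠ a | v ≟ᶠ parent a | v ≟ᶠ root a
    ... | yes refl | _ | _ = inj₂ (reroot-parent v b moved)
    ... | no _ | yes refl | _ = inj₂ (reroot-grandparent a b root≢a moved)
      where
      root≢a : root a ≢ a
      root≢a fixed = moved (trans (sym (height≤2 a)) (cong parent fixed))
    ... | no _ | no _ | yes refl = ⊥-elim (moved (height≤2 a))
    ... | no _ | no _ | no _ = inj₁ refl

base6-lex-< : ∀ {k l} i j → k < l → i ≤ 5 → k * 6 + i < l * 6 + j
base6-lex-< {k} {l} i j k<l i≤5 = begin-strict
  k * 6 + i ≤⟨ +-monoʳ-≤ (k * 6) i≤5 ⟩
  k * 6 + 5 <⟨ +-monoʳ-< (k * 6) (n<1+n 5) ⟩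
  k * 6 + 6 ≡⟨ +-comm (k * 6) 6 ⟩
  suc k * 6 ≤⟨ *-monoˡ-≤ 6 k<l ⟩
  l * 6     ≤⟨ m≤m+n (l * 6) j ⟩
  l * 6 + j ∎
  where open ≤-Reasoning

module SpanningExtension {n} (G : Graph n) (conn : Connected G) (F : HeightTwoForest G) (z : Fin n) where
  open HeightTwoForest F
  open Rerooting F
  open Layering G conn root z

  -- The tree of x is entered at a from a vertex b of a lower layer, or it is the tree of layer 0
  -- and keeps its root a.
  Anchored : Fin n → Fin n → Fin n → Set
  Anchored x a b = root a ≡ root x ×
    ((b ≡ a × parent a ≡ a × layer x ≡ 0) ⊎ (Adj G b a × layer b < layer x))

  anchored-resp : ∀ {x y a b} → root x ≡ root y → Anchored x a b → Anchored y a b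
  anchored-resp eq (same-tree , inj₁ (b≡a , fixed , base)) =
    trans same-tree eq , inj₁ (b≡a , fixed , trans (sym (layer-resp eq)) base)
  anchored-resp eq (same-tree , inj₂ (ba , lower)) =
    trans same-tree eq , inj₂ (ba , subst (_ <_) (layer-resp eq) lower)

  anchoring : ∀ x → ∃₂ (Anchored x)
  anchoring x with layer x in eq
  ... | zero  = root x , root x , root-root x , inj₁ (refl , height≤2 x , refl)
  ... | suc k = let a , b , same-tree , ba , lower = entry eq
                in  a , b , same-tree , inj₂ (ba , subst (layer b <_) eq lower)

  anchor attachment : Fin n → Fin n
  anchor     v = proj₁ (anchoring (root v))
  attachment v = proj₁ (proj₂ (anchoring (root v)))

  anchored : ∀ v → Anchored v (anchor v) (attachment v)
  anchored v = anchored-resp (root-root v) (proj₂ (proj₂ (anchoring (root v))))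

  anchor-resp : ∀ {u v} → root u ≡ root v → anchor u ≡ anchor v × attachment u ≡ attachment v
  anchor-resp eq = cong (λ x → proj₁ (anchoring x)) eq , cong (λ x → proj₁ (proj₂ (anchoring x))) eq

  up : Fin n → Fin n
  up v = reroot (anchor v) (attachment v) v

  -- position ≤ 5, so the layer of the tree is the leading digit of the rank
  rank : Fin n → ℕ
  rank v = layer v * 6 + position (anchor v) v

  rank-in-tree : ∀ {u v} → root u ≡ root v → rank u ≡ layer v * 6 + position (anchor v) u
  rank-in-tree {u} eq = cong₂ (λ l a → l * 6 + position a u) (layer-resp eq) (proj₁ (anchor-resp eq))

  up-anchor : ∀ {v} → v ≡ anchor v → up v ≡ attachment v
  up-anchor {v} v≡a = trans (cong (reroot (anchor v) (attachment v)) v≡a) (reroot-self _ _)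

  leaves-tree : ∀ {v} → v ≡ anchor v → up v ≢ v → Adj G v (up v) × layer (up v) < layer v
  leaves-tree {v} v≡a moved with anchored v
  ... | _ , inj₁ (b≡a , _)    = ⊥-elim (moved (trans (up-anchor v≡a) (trans b≡a (sym v≡a))))
  ... | _ , inj₂ (ba , lower) rewrite up-anchor v≡a =
    subst (λ u → Adj G u (attachment v)) (sym v≡a) (adj-sym G ba) , lower

  rank-up : ∀ v → up v ≢ v → rank (up v) < rank v
  rank-up v moved with v ≟ᶠ anchor v
  ... | yes v≡a = base6-lex-< _ _ (proj₂ (leaves-tree v≡a moved)) (position≤5 _ _)
  ... | no v≢a  = subst (_< rank v) (sym (rank-in-tree (reroot-root _ _ v v≢a)))
                    (+-monoʳ-< (layer v * 6) (reroot-position _ _ v v≢a moved))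

  up-adj : ∀ v → up v ≢ v → Adj G v (up v)
  up-adj v moved with v ≟ᶠ anchor v
  ... | yes v≡a = proj₁ (leaves-tree v≡a moved)
  ... | no v≢a  = reroot-adj _ _ v v≢a moved

  up-fixed : ∀ v → up v ≡ v → v ≡ root z
  up-fixed v fixed with anchored v
  ... | same-tree , inj₂ (ba , _) = ⊥-elim (adj⇒≢ G ba (proj₂ (reroot-fixed _ _ v same-tree fixed)))
  ... | same-tree , inj₁ (_ , a-fixed , base) =
    let v≡a = proj₁ (reroot-fixed _ _ v same-tree fixed)
    in  trans (sym (root-fixed (trans (cong parent v≡a) (trans a-fixed (sym v≡a))))) (layer-zero base)

  open ParentGraph up
  open Ranked rank rank-up

  up-parent : ∀ v → up (parent v) ≡ reroot (anchor v) (attachment v) (parent v)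
  up-parent v = let a≡a′ , b≡b′ = anchor-resp (root-parent v)
                in  cong₂ (λ a b → reroot a b (parent v)) a≡a′ b≡b′

  keeps-forest : ∀ v → parent v ≢ v → Adj graph v (parent v)
  keeps-forest v moved with reroot-keeps-edge (anchor v) (attachment v) v moved
  ... | inj₁ forward  = parent-edge forward (moved ∘ sym)
  ... | inj₂ backward = adj-sym graph (parent-edge (trans (up-parent v) backward) moved)

  spanning : SpanningSubgraph graph G
  spanning u v uv with adj⇒linked uv
  ... | inj₁ up-u≡v , u≢v = subst (Adj G u) up-u≡v (up-adj u λ fixed → u≢v (trans (sym fixed) up-u≡v))
  ... | inj₂ up-v≡u , u≢v =
    adj-sym G (subst (Adj G v) up-v≡u (up-adj v λ fixed → u≢v (trans (sym up-v≡u) fixed)))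

  spanning-tree : IsSpanningTree graph G
  spanning-tree = spanning , connected (root z) up-fixed , acyclic

spanning-tree-extending : ∀ {n} {G : Graph n} → Connected G → (F : HeightTwoForest G) →
  let open HeightTwoForest F in
  ∃ λ T → IsSpanningTree T G × (∀ v → parent v ≢ v → Adj T v (parent v))
spanning-tree-extending {zero}  {G} conn F = G , ((λ _ _ uv → uv) , conn , no-cycle) , λ ()
  where
  no-cycle : Acyclic G
  no-cycle []      (() , _)
  no-cycle (() ∷ _) _
spanning-tree-extending {suc n} {G} conn F =
  graph , spanning-tree , keeps-forest
  where open SpanningExtension G conn F fzero
        open ParentGraph up using (graph)

dist≤2-mono : ∀ {n} (H G : Graph n) → SpanningSubgraph H G → ∀ {u v} → Dist≤2 H u v → Dist≤2 G u v
dist≤2-mono _ _ sub (inj₁ u≡v)                = inj₁ u≡v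
dist≤2-mono _ _ sub (inj₂ (inj₁ uv))          = inj₂ (inj₁ (sub _ _ uv))
dist≤2-mono _ _ sub (inj₂ (inj₂ (w , uw , wv))) = inj₂ (inj₂ (w , sub _ _ uw , sub _ _ wv))

module Projection {n} (G : Graph n) (X : Subset n) (domInd : IsDomInd22 G X) where

  -- An X-neighbour is preferred, so the middle vertex of a via-route is itself sent into X.
  data Route (v : Fin n) : Set where
    inside : v ∈ X → Route v
    beside : ∀ x → x ∈ X → Adj G v x → v ∉ X → Route v
    via    : ∀ w x → x ∈ X → Adj G v w → Adj G w x → v ∉ X →
             (∀ y → y ∈ X → ¬ Adj G v y) → Route v

  route : ∀ v → Route v
  route v with v ∈? X
  ... | yes v∈ = inside v∈
  ... | no v∉ with any? (λ x → (x ∈? X) ×-dec adj? G v x)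
  ...   | yes (x , x∈ , vx) = beside x x∈ vx v∉
  ...   | no isolated with proj₁ domInd v v∉
  ...     | x , x∈ , inj₁ x≡v = ⊥-elim (v∉ (subst (_∈ X) x≡v x∈))
  ...     | x , x∈ , inj₂ (inj₁ xv) = ⊥-elim (isolated (x , x∈ , adj-sym G xv))
  ...     | x , x∈ , inj₂ (inj₂ (w , xw , wv)) =
    via w x x∈ (adj-sym G wv) (adj-sym G xw) v∉ λ y y∈ vy → isolated (y , y∈ , vy)

  next : ∀ {v} → Route v → Fin n
  next {v} (inside _)          = v
  next (beside x _ _ _)        = x
  next (via w _ _ _ _ _ _)     = w

  proj : Fin n → Fin n
  proj v = next (route v)

  proj-member : ∀ {v} → v ∈ X → proj v ≡ v
  proj-member {v} v∈ with route v
  ... | inside _                = refl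
  ... | beside _ _ _ v∉         = ⊥-elim (v∉ v∈)
  ... | via _ _ _ _ _ v∉ _      = ⊥-elim (v∉ v∈)

  proj-adj : ∀ {v} → v ∉ X → Adj G v (proj v)
  proj-adj {v} v∉ with route v
  ... | inside v∈               = ⊥-elim (v∉ v∈)
  ... | beside _ _ vx _         = vx
  ... | via _ _ _ vw _ _ _      = vw

  proj-moves : ∀ {v} → v ∉ X → proj v ≢ v
  proj-moves v∉ = adj⇒≢ G (proj-adj v∉) ∘ sym

  proj-beside : ∀ {v x} → x ∈ X → Adj G v x → proj v ∈ X
  proj-beside {v} x∈ vx with route v
  ... | inside v∈               = ⊥-elim (proj₂ domInd v _ v∈ x∈ (adj⇒≢ G vx) (inj₂ (inj₁ vx)))
  ... | beside _ x′∈ _ _        = x′∈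
  ... | via _ _ _ _ _ _ isolated = ⊥-elim (isolated _ x∈ vx)

  proj²-member : ∀ v → proj (proj v) ∈ X
  proj²-member v with route v
  ... | inside v∈               = subst (_∈ X) (sym (proj-member v∈)) v∈
  ... | beside _ x∈ _ _         = subst (_∈ X) (sym (proj-member x∈)) x∈
  ... | via _ _ x∈ _ wx _ _     = proj-beside x∈ wx

  forest : HeightTwoForest G
  forest = record
    { parent     = proj
    ; parent-adj = λ v moved → proj-adj (moved ∘ proj-member)
    ; height≤2   = λ v → proj-member (proj²-member v)
    }

  domInd-subgraph : ∀ T → SpanningSubgraph T G → (∀ v → proj v ≢ v → Adj T v (proj v)) →
                    IsDomInd22 T X
  domInd-subgraph T sub keeps =
    dominated , λ x y x∈ y∈ x≢y d → proj₂ domInd x y x∈ y∈ x≢y (dist≤2-mono T G sub d)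
    where
    dominated : ∀ v → v ∉ X → ∃ λ x → x ∈ X × Dist≤2 T x v
    dominated v v∉ with proj v ∈? X
    ... | yes pv∈ = proj v , pv∈ , inj₂ (inj₁ (adj-sym T (keeps v (proj-moves v∉))))
    ... | no pv∉  = proj (proj v) , proj²-member v ,
                    inj₂ (inj₂ (proj v , adj-sym T (keeps (proj v) (proj-moves pv∉)) ,
                                 adj-sym T (keeps v (proj-moves v∉))))

dist≤2? : ∀ {n} (H : Graph n) u v → Dec (Dist≤2 H u v)
dist≤2? H u v = (u ≟ᶠ v) ⊎-dec adj? H u v ⊎-dec any? λ w → adj? H u w ×-dec adj? H w v

domInd? : ∀ {n} (H : Graph n) → Decidable (IsDomInd22 H)
domInd? H Y =
  all? (λ v → ¬? (v ∈? Y) →-dec any? λ x → (x ∈? Y) ×-dec dist≤2? H x v) ×-dec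
  all? (λ x → all? λ y → (x ∈? Y) →-dec (y ∈? Y) →-dec ¬? (x ≟ᶠ y) →-dec ¬? (dist≤2? H x y))

γ₂²-exists : ∀ {n} (H : Graph n) Y → IsDomInd22 H Y → ∃ λ t → IsGamma22 H t × t ≤ ∣ Y ∣
γ₂²-exists H Y domY
  with least (λ k → anySubset? λ Z → domInd? H Z ×-dec (∣ Z ∣ ≟ⁿ k)) ∣ Y ∣ (Y , domY , refl)
... | t , attained , minimal =
  t , (attained , λ Z domZ → minimal _ (Z , domZ , refl)) , minimal _ (Y , domY , refl)

proposition6p1 : ∀ (n : ℕ) (G : Graph n) → Connected G →
    ∀ (g : ℕ) → IsGamma22 G g →
    ∃ λ (T : Graph n) → IsSpanningTree T G × (∃ λ (t : ℕ) → IsGamma22 T t × t ≤ g)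
proposition6p1 n G conn g ((X , domX , size) , _) =
  let T , (sub , tree) , keeps = spanning-tree-extending conn forest
      t , γ-T , t≤∣X∣          = γ₂²-exists T X (domInd-subgraph T sub keeps)
  in  T , (sub , tree) , t , γ-T , subst (t ≤_) size t≤∣X∣
  where open Projection G X domX
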